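{- Let $G$ be a chordal graph with non-negative edge weights. Then $G$ has a maximum weight matching $M$ such that for every minimal separator $S$ of $G$, $|S|-1\le |V(M)\cap S|\le |S|$.
   Context: $V(M)$ denotes the set of endpoints of edges of a matching $M$. A maximum weight matching is a matching maximizing the sum of its edge weights over all matchings of $G$. A minimal separator of $G$ is a set $S\subseteq V(G)$ such that for some two vertices $a,b$ in different connected components of $G-S$, $S$ is inclusion-minimal with this property. A graph is chordal if it has no induced cycle of length greater than $3$.
   Formalization: The edge weights are non-negative rationals rather than non-negative reals. -}

module Defs where

open import Data.Nat using (ℕ; zero; suc; _+_; _%_)
open import Data.Fin using (Fin; toℕ)
open import Data.Fin.Subset using (Subset; _∈_; _∉_; _⊂_; ∣_∣)
open import Data.Fin.Subset.Properties using (_∈?_)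
open import Data.Bool using (Bool; T)
open import Data.Product using (_×_; _,_; Σ; ∃; ∃-syntax)
open import Data.Sum using (_⊎_)
open import Data.List using (List; []; _∷_; concatMap; filter; length; foldr; map)
open import Data.List.Relation.Unary.All using (All)
open import Data.List.Relation.Unary.Unique.Propositional using (Unique)
open import Data.Rational using (ℚ; 0ℚ) renaming (_+_ to _+ℚ_; _≤_ to _≤ℚ_)
open import Relation.Binary.PropositionalEquality using (_≡_)
open import Relation.Nullary using (¬_)
open import Function.Definitions using (Injective)
open import Function.Bundles using (_⇔_)

record Graph : Set where
  field
    n    : ℕ
    E    : Fin n → Fin n → Bool
    sym  : ∀ u v → E u v ≡ E v u
    irr  : ∀ u → ¬ T (E u u)

module _ (G : Graph) where
  open Graph G

  Adj : Fin n → Fin n → Set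
  Adj u v = T (E u v)

  IsInducedCycle : (m : ℕ) → (Fin (4 + m) → Fin n) → Set
  IsInducedCycle m c =
    Injective _≡_ _≡_ c ×
    (∀ i j → Adj (c i) (c j) ⇔
       (toℕ j ≡ suc (toℕ i) % (4 + m) ⊎ toℕ i ≡ suc (toℕ j) % (4 + m)))

  Chordal : Set
  Chordal = ∀ m (c : Fin (4 + m) → Fin n) → ¬ IsInducedCycle m c

  data ConnectedIn (S : Subset n) (a : Fin n) : Fin n → Set where
    here : a ∉ S → ConnectedIn S a a
    step : ∀ {u v} → ConnectedIn S a u → Adj u v → v ∉ S → ConnectedIn S a v

  Separates : Subset n → Fin n → Fin n → Set
  Separates S a b = a ∉ S × b ∉ S × ¬ ConnectedIn S a b

  MinimalSeparator : Subset n → Set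
  MinimalSeparator S = ∃[ a ] ∃[ b ]
    (Separates S a b × (∀ T → T ⊂ S → ¬ Separates T a b))

  endpoints : List (Fin n × Fin n) → List (Fin n)
  endpoints = concatMap (λ { (u , v) → u ∷ v ∷ [] })

  IsMatching : List (Fin n × Fin n) → Set
  IsMatching M = All (λ { (u , v) → Adj u v }) M × Unique (endpoints M)

  -- |V(M) ∩ S|  (endpoints are distinct, so this counts each vertex once)
  coveredIn : List (Fin n × Fin n) → Subset n → ℕ
  coveredIn M S = length (filter (_∈? S) (endpoints M))

  weight : (Fin n → Fin n → ℚ) → List (Fin n × Fin n) → ℚ
  weight w M = foldr _+ℚ_ 0ℚ (map (λ { (u , v) → w u v }) M)

  IsMaxWeightMatching : (Fin n → Fin n → ℚ) → List (Fin n × Fin n) → Set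
  IsMaxWeightMatching w M =
    IsMatching M × (∀ M′ → IsMatching M′ → weight w M′ ≤ℚ weight w M)

module Submission where

-- Take a matching of maximum weight and, among those, of maximum size. Since the weights are
-- non-negative it is inclusion-maximal, so every edge has a covered endpoint. In a chordal graph
-- every minimal separator S is a clique (Dirac): if x, y ∈ S were non-adjacent, both would have
-- neighbours in the components of a and of b, and shortest x–y paths through these two components
-- would glue into an induced cycle of length at least 4. So at most one vertex of S is uncovered;
-- the upper bound holds because the endpoints of a matching are distinct.

open import Data.Bool using (T)
open import Data.Empty using (⊥-elim)
open import Data.Fin using (Fin; zero; suc; toℕ) renaming (_≟_ to _≟ᶠ_)
open import Data.Fin.Properties using (any?; toℕ-injective; toℕ<n)
open import Data.Fin.Subset using (Subset; _∈_; _∉_; _-_; ⁅_⁆; ⊤; ⊥; ∣_∣; outside; inside; _⊂_)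
open import Data.Fin.Subset.Properties
  using (_∈?_; ∈⊤; ∣⊤∣≡n; ∣⊥∣≡0; ∣⁅x⁆∣≡1; x∈⁅x⁆; p─⊥≡p; p─q⊆p; p⊆q⇒∣p∣≤∣q∣; x∈p⇒∣p-x∣<∣p∣;
         x∈p∧x≢y⇒x∈p-y; x∈p⇒p-x⊂p)
open import Data.List using (List; []; _∷_; filter; length; cartesianProduct; cartesianProductWith; allFin)
import Data.List.Extrema as Extrema
open import Data.List.Membership.Propositional using () renaming (_∈_ to _∈ˡ_; _∉_ to _∉ˡ_)
open import Data.List.Membership.Propositional.Properties
  using (∈-filter⁺; ∈-cartesianProduct⁺; ∈-cartesianProductWith⁺; ∈-allFin)
import Data.List.Membership.DecPropositional as MembershipDec
open import Data.List.Properties using (filter-accept; filter-reject; filter-all)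
open import Data.List.Relation.Unary.All as All using (All; []; _∷_)
open import Data.List.Relation.Unary.All.Properties using (all-filter; ¬Any⇒All¬)
open import Data.List.Relation.Unary.AllPairs using ([]; _∷_)
open import Data.List.Relation.Unary.Any using (here; there)
open import Data.List.Relation.Unary.Unique.Propositional using (Unique)
import Data.List.Relation.Unary.Unique.DecPropositional as UniqueDec
open import Data.Nat using (ℕ; zero; suc; _+_; _∸_; _%_; _≤_; _<_; _≤?_; z≤n; s≤s)
open import Data.Nat.DivMod using (m<n⇒m%n≡m; n%n≡0)
open import Data.Nat.Induction using (<-rec)
import Data.Nat.Properties as ℕ
open import Data.Nat.Tactic.RingSolver using (solve-∀)
open import Data.Product using (_×_; _,_; proj₁; proj₂; ∃₂; ∃-syntax)
open import Data.Product.Relation.Binary.Lex.NonStrict using (×-totalOrder)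
open import Data.Rational using (ℚ; 0ℚ) renaming (_≤_ to _≤ℚ_)
import Data.Rational.Properties as ℚ
open import Data.Sum using (_⊎_; inj₁; inj₂; [_,_])
open import Data.Vec using (_∷_)
import Data.Vec as Vec
open import Function using (_∘_)
open import Function.Bundles using (mk⇔)
open import Relation.Binary.Bundles using (TotalOrder)
open import Relation.Binary.Definitions using (tri<; tri≈; tri>)
open import Relation.Binary.PropositionalEquality
  using (_≡_; _≢_; refl; sym; trans; cong; subst; subst₂; module ≡-Reasoning)
open import Relation.Nullary using (¬_; yes; no; contradiction)
open import Relation.Nullary.Decidable using (T?; _×-dec_)
open import Relation.Unary using (Decidable)

open import Defs

count : ∀ {n} → Subset n → List (Fin n) → ℕ
count p xs = length (filter (_∈? p) xs)

x∉p-x : ∀ {n} (p : Subset n) x → x ∉ p - x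
x∉p-x (_ ∷ p) (suc x) (Vec.there x∈p-x) = x∉p-x p x x∈p-x

∣p∣≤1+∣p-x∣ : ∀ {n} (p : Subset n) x → ∣ p ∣ ≤ suc ∣ p - x ∣
∣p∣≤1+∣p-x∣ (outside ∷ p) zero    = ℕ.m≤n⇒m≤1+n (ℕ.≤-reflexive (cong ∣_∣ (sym (p─⊥≡p p))))
∣p∣≤1+∣p-x∣ (inside  ∷ p) zero    = s≤s (ℕ.≤-reflexive (cong ∣_∣ (sym (p─⊥≡p p))))
∣p∣≤1+∣p-x∣ (outside ∷ p) (suc x) = ∣p∣≤1+∣p-x∣ p x
∣p∣≤1+∣p-x∣ (inside  ∷ p) (suc x) = s≤s (∣p∣≤1+∣p-x∣ p x)

∣p∣≤1 : ∀ {n} {p : Subset n} → (∀ {y z} → y ∈ p → z ∈ p → y ≡ z) → ∣ p ∣ ≤ 1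
∣p∣≤1 {n} {p} subsingleton with any? (_∈? p)
... | yes (x , x∈p) = ℕ.≤-trans (p⊆q⇒∣p∣≤∣q∣ ⊆⁅x⁆) (ℕ.≤-reflexive (∣⁅x⁆∣≡1 x))
  where
  ⊆⁅x⁆ : ∀ {y} → y ∈ p → y ∈ ⁅ x ⁆
  ⊆⁅x⁆ y∈p rewrite subsingleton y∈p x∈p = x∈⁅x⁆ x
... | no ∄ = ℕ.≤-trans (p⊆q⇒∣p∣≤∣q∣ {q = ⊥} λ {y} y∈p → ⊥-elim (∄ (y , y∈p)))
                     (ℕ.≤-trans (ℕ.≤-reflexive (∣⊥∣≡0 n)) z≤n)

count[p-x]≡count[p] : ∀ {n} (p : Subset n) {x} xs → All (x ≢_) xs → count (p - x) xs ≡ count p xs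
count[p-x]≡count[p] p []       []          = refl
count[p-x]≡count[p] p (y ∷ xs) (x≢y ∷ x≢xs) with y ∈? p
... | yes y∈p = begin
  count (p - _) (y ∷ xs)  ≡⟨ cong length (filter-accept (_∈? (p - _)) (x∈p∧x≢y⇒x∈p-y y∈p (x≢y ∘ sym))) ⟩
  suc (count (p - _) xs)  ≡⟨ cong suc (count[p-x]≡count[p] p xs x≢xs) ⟩
  suc (count p xs)        ∎
  where open ≡-Reasoning
... | no y∉p = trans (cong length (filter-reject (_∈? (p - _)) (λ y∈p-x → y∉p (p─q⊆p p _ y∈p-x))))
                     (count[p-x]≡count[p] p xs x≢xs)

count≤∣p∣ : ∀ {n} (p : Subset n) {xs} → Unique xs → count p xs ≤ ∣ p ∣
count≤∣p∣ p {[]}     []              = z≤n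
count≤∣p∣ p {x ∷ xs} (x≢xs ∷ unique) with x ∈? p
... | yes x∈p = begin-strict
  count p xs       ≡⟨ count[p-x]≡count[p] p xs x≢xs ⟨
  count (p - x) xs ≤⟨ count≤∣p∣ (p - x) unique ⟩
  ∣ p - x ∣        <⟨ x∈p⇒∣p-x∣<∣p∣ x∈p ⟩
  ∣ p ∣            ∎
  where open ℕ.≤-Reasoning
... | no _    = count≤∣p∣ p unique

length≤n : ∀ {n} {xs : List (Fin n)} → Unique xs → length xs ≤ n
length≤n {n} {xs} unique = begin
  length xs   ≡⟨ cong length (filter-all (_∈? ⊤) {xs} (All.tabulate (λ _ → ∈⊤))) ⟨
  count ⊤ xs  ≤⟨ count≤∣p∣ (⊤ {n}) unique ⟩
  ∣ ⊤ {n} ∣   ≡⟨ ∣⊤∣≡n n ⟩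
  n           ∎
  where open ℕ.≤-Reasoning

∉-∷⁺ : ∀ {n} {x y : Fin n} {xs} → y ≢ x → y ∉ˡ xs → y ∉ˡ x ∷ xs
∉-∷⁺ y≢x _    (here y≡x)   = y≢x y≡x
∉-∷⁺ _   y∉xs (there y∈xs) = y∉xs y∈xs

∣p∣≤1+count : ∀ {n} (p : Subset n) {xs} → Unique xs →
  (∀ {y z} → y ∈ p → y ∉ˡ xs → z ∈ p → z ∉ˡ xs → y ≡ z) → ∣ p ∣ ≤ suc (count p xs)
∣p∣≤1+count p {[]}     []              atMostOneMissing =
  ∣p∣≤1 (λ y∈p z∈p → atMostOneMissing y∈p (λ ()) z∈p (λ ()))
∣p∣≤1+count p {x ∷ xs} (x≢xs ∷ unique) atMostOneMissing with x ∈? p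
... | yes x∈p = begin
  ∣ p ∣                        ≤⟨ ∣p∣≤1+∣p-x∣ p x ⟩
  suc ∣ p - x ∣                ≤⟨ s≤s (∣p∣≤1+count (p - x) unique atMostOneMissing′) ⟩
  suc (suc (count (p - x) xs)) ≡⟨ cong (λ (k : ℕ) → suc (suc k)) (count[p-x]≡count[p] p xs x≢xs) ⟩
  suc (suc (count p xs))       ∎
  where
  open ℕ.≤-Reasoning
  ≢x : ∀ {y} → y ∈ p - x → y ≢ x
  ≢x y∈p-x refl = x∉p-x p x y∈p-x
  atMostOneMissing′ : ∀ {y z} → y ∈ p - x → y ∉ˡ xs → z ∈ p - x → z ∉ˡ xs → y ≡ z
  atMostOneMissing′ y∈ y∉ z∈ z∉ =
    atMostOneMissing (p─q⊆p p ⁅ x ⁆ y∈) (∉-∷⁺ (≢x y∈) y∉) (p─q⊆p p ⁅ x ⁆ z∈) (∉-∷⁺ (≢x z∈) z∉)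
... | no x∉p = ∣p∣≤1+count p unique atMostOneMissing′
  where
  ≢x : ∀ {y} → y ∈ p → y ≢ x
  ≢x y∈p refl = x∉p y∈p
  atMostOneMissing′ : ∀ {y z} → y ∈ p → y ∉ˡ xs → z ∈ p → z ∉ˡ xs → y ≡ z
  atMostOneMissing′ y∈ y∉ z∈ z∉ = atMostOneMissing y∈ (∉-∷⁺ (≢x y∈) y∉) z∈ (∉-∷⁺ (≢x z∈) z∉)

interior-or-end : ∀ {i L} → i ≤ L → i ≡ 0 ⊎ i ≡ L ⊎ (0 < i × i < L)
interior-or-end {zero}  _   = inj₁ refl
interior-or-end {suc i} {L} i≤L with suc i ℕ.≟ L
... | yes i≡L = inj₂ (inj₁ i≡L)
... | no  i≢L = inj₂ (inj₂ (s≤s z≤n , ℕ.≤∧≢⇒< i≤L i≢L))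

module Matchings (G : Graph) where
  open Graph G using (n; E; irr)
  open MembershipDec (_≟ᶠ_ {n}) using () renaming (_∈?_ to _∈ˡ?_)

  Edge : Set
  Edge = Fin n × Fin n

  isMatching? : Decidable (IsMatching G)
  isMatching? M = All.all? (λ (u , v) → T? (E u v)) M ×-dec UniqueDec.unique? _≟ᶠ_ (endpoints G M)

  listsOfLength≤ : ℕ → List (List Edge)
  listsOfLength≤ zero    = [] ∷ []
  listsOfLength≤ (suc k) =
    [] ∷ cartesianProductWith _∷_ (cartesianProduct (allFin n) (allFin n)) (listsOfLength≤ k)

  ∈-listsOfLength≤ : ∀ k {M} → length M ≤ k → M ∈ˡ listsOfLength≤ k
  ∈-listsOfLength≤ zero    {[]}          _            = here refl
  ∈-listsOfLength≤ (suc k) {[]}          _            = here refl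
  ∈-listsOfLength≤ (suc k) {(u , v) ∷ M} (s≤s |M|≤k) =
    there (∈-cartesianProductWith⁺ _∷_ (∈-cartesianProduct⁺ (∈-allFin u) (∈-allFin v))
                                       (∈-listsOfLength≤ k |M|≤k))

  length≤length-endpoints : ∀ M → length M ≤ length (endpoints G M)
  length≤length-endpoints []      = z≤n
  length≤length-endpoints (_ ∷ M) = s≤s (ℕ.m≤n⇒m≤1+n (length≤length-endpoints M))

  matchings : List (List Edge)
  matchings = filter isMatching? (listsOfLength≤ n)

  ∈-matchings : ∀ {M} → IsMatching G M → M ∈ˡ matchings
  ∈-matchings {M} isM = ∈-filter⁺ isMatching? (∈-listsOfLength≤ n |M|≤n) isM
    where
    |M|≤n : length M ≤ n
    |M|≤n = ℕ.≤-trans (length≤length-endpoints M) (length≤n (proj₂ isM))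

  ∣S∣∸1≤coveredIn : ∀ {M} → IsMatching G M → (∀ {u v} → Adj G u v → u ∈ˡ endpoints G M ⊎ v ∈ˡ endpoints G M) →
    ∀ {S} → (∀ {x y} → x ∈ S → y ∈ S → x ≢ y → Adj G x y) → ∣ S ∣ ∸ 1 ≤ coveredIn G M S
  ∣S∣∸1≤coveredIn {M} (_ , unique) covers {S} clique = ℕ.∸-monoˡ-≤ 1 (∣p∣≤1+count S unique atMostOneUncovered)
    where
    atMostOneUncovered : ∀ {y z} → y ∈ S → y ∉ˡ endpoints G M → z ∈ S → z ∉ˡ endpoints G M → y ≡ z
    atMostOneUncovered {y} {z} y∈S y∉M z∈S z∉M with y ≟ᶠ z
    ... | yes y≡z = y≡z
    ... | no  y≢z = ⊥-elim ([ y∉M , z∉M ] (covers (clique y∈S z∈S y≢z)))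

  module _ (w : Fin n → Fin n → ℚ) where
    lex : TotalOrder _ _ _
    lex = ×-totalOrder ℚ.≤-decTotalOrder ℕ.≤-totalOrder
    open TotalOrder lex using () renaming (_≤_ to _≤ₗₑₓ_)
    open Extrema lex using (argmax; argmax-all; f[xs]≤f[argmax])

    -- Ties in weight are broken by size, which makes the chosen matching inclusion-maximal.
    rank : List Edge → ℚ × ℕ
    rank M = weight G w M , length M

    heaviest : List Edge
    heaviest = argmax rank [] matchings

    heaviest-isMatching : IsMatching G heaviest
    heaviest-isMatching = argmax-all rank ([] , []) (all-filter isMatching? (listsOfLength≤ n))

    rank≤rank[heaviest] : ∀ {M} → IsMatching G M → rank M ≤ₗₑₓ rank heaviest
    rank≤rank[heaviest] isM = All.lookup (f[xs]≤f[argmax] [] matchings) (∈-matchings isM)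

    heaviest-isMaxWeight : IsMaxWeightMatching G w heaviest
    heaviest-isMaxWeight = heaviest-isMatching , λ M isM → weight≤ {M} (rank≤rank[heaviest] isM)
      where
      weight≤ : ∀ {M} → rank M ≤ₗₑₓ rank heaviest → weight G w M ≤ℚ weight G w heaviest
      weight≤ (inj₁ (w≤ , _))  = w≤
      weight≤ (inj₂ (w≡ , _))  = ℚ.≤-reflexive w≡

    heaviest-maximal : (∀ u v → Adj G u v → 0ℚ ≤ℚ w u v) →
      ∀ {u v} → Adj G u v → u ∈ˡ endpoints G heaviest ⊎ v ∈ˡ endpoints G heaviest
    heaviest-maximal nonneg {u} {v} uv with u ∈ˡ? endpoints G heaviest | v ∈ˡ? endpoints G heaviest
    ... | yes u∈ | _      = inj₁ u∈
    ... | no _   | yes v∈ = inj₂ v∈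
    ... | no u∉  | no v∉  = ⊥-elim (not-larger (rank≤rank[heaviest] extended-isMatching))
      where
      extended = (u , v) ∷ heaviest
      extended-isMatching : IsMatching G extended
      extended-isMatching =
        uv ∷ proj₁ heaviest-isMatching ,
        ((λ { refl → irr u uv }) ∷ ¬Any⇒All¬ _ u∉) ∷ ¬Any⇒All¬ _ v∉ ∷ proj₂ heaviest-isMatching
      heavier : weight G w heaviest ≤ℚ weight G w extended
      heavier = subst (_≤ℚ weight G w extended) (ℚ.+-identityˡ (weight G w heaviest))
                      (ℚ.+-monoˡ-≤ (weight G w heaviest) (nonneg u v uv))
      not-larger : ¬ rank extended ≤ₗₑₓ rank heaviest
      not-larger (inj₁ (lighter , ≢)) = ≢ (ℚ.≤-antisym lighter heavier)
      not-larger (inj₂ (_ , longer)) = ℕ.<-irrefl refl longer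

module Walks (G : Graph) where
  open Graph G using (n; irr) renaming (sym to E-sym)

  Adj-sym : ∀ {u v} → Adj G u v → Adj G v u
  Adj-sym {u} {v} = subst T (E-sym u v)

  connected-end∉ : ∀ {S a v} → ConnectedIn G S a v → v ∉ S
  connected-end∉ (here a∉S)     = a∉S
  connected-end∉ (step _ _ v∉S) = v∉S

  connected-trans : ∀ {S a u v} → ConnectedIn G S a u → ConnectedIn G S u v → ConnectedIn G S a v
  connected-trans a⇝u (here _)          = a⇝u
  connected-trans a⇝u (step u⇝w wv v∉S) = step (connected-trans a⇝u u⇝w) wv v∉S

  connected-sym : ∀ {S a v} → ConnectedIn G S a v → ConnectedIn G S v a
  connected-sym (here a∉S)          = here a∉S
  connected-sym (step a⇝u uv v∉S) =
    connected-trans (step (here v∉S) (Adj-sym uv) (connected-end∉ a⇝u)) (connected-sym a⇝u)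

  -- Only α 0, …, α L matter; the values of α beyond L are junk.
  record Walk (P : Fin n → Set) (x y : Fin n) (L : ℕ) (α : ℕ → Fin n) : Set where
    field
      start : α 0 ≡ x
      end   : α L ≡ y
      steps : ∀ {i} → i < L → Adj G (α i) (α (suc i))
      inner : ∀ {i} → 0 < i → i < L → P (α i)

  module _ {P : Fin n → Set} where

    trivialWalk : ∀ {x} → Walk P x x 0 (λ _ → x)
    trivialWalk = record { start = refl ; end = refl ; steps = λ () ; inner = λ _ () }

    snoc : (ℕ → Fin n) → ℕ → Fin n → ℕ → Fin n
    snoc α L z k with k ≤? L
    ... | yes _ = α k
    ... | no  _ = z

    snoc-≤ : ∀ α {L} z {k} → k ≤ L → snoc α L z k ≡ α k
    snoc-≤ α {L} z {k} k≤L with k ≤? L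
    ... | yes _   = refl
    ... | no  k≰L = contradiction k≤L k≰L

    snoc-> : ∀ α {L} z {k} → L < k → snoc α L z k ≡ z
    snoc-> α {L} z {k} L<k with k ≤? L
    ... | yes k≤L = contradiction L<k (ℕ.≤⇒≯ k≤L)
    ... | no  _   = refl

    snocWalk : ∀ {x y z L α} → Walk P x y L α → (0 < L → P y) → Adj G y z → Walk P x z (suc L) (snoc α L z)
    snocWalk {x} {y} {z} {L} {α} w Py yz = record
      { start = trans (snoc-≤ α {L} z z≤n) start
      ; end   = snoc-> α {L} z ℕ.≤-refl
      ; steps = steps′
      ; inner = inner′
      }
      where
      open Walk w
      steps′ : ∀ {i} → i < suc L → Adj G (snoc α L z i) (snoc α L z (suc i))
      steps′ {i} (s≤s i≤L) with ℕ.m≤n⇒m<n∨m≡n i≤L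
      ... | inj₁ i<L  = subst₂ (Adj G) (sym (snoc-≤ α z i≤L)) (sym (snoc-≤ α z i<L)) (steps i<L)
      ... | inj₂ refl = subst₂ (Adj G) (sym (trans (snoc-≤ α z i≤L) end)) (sym (snoc-> α {L} z ℕ.≤-refl)) yz
      inner′ : ∀ {i} → 0 < i → i < suc L → P (snoc α L z i)
      inner′ {i} 0<i (s≤s i≤L) with ℕ.m≤n⇒m<n∨m≡n i≤L
      ... | inj₁ i<L  = subst P (sym (snoc-≤ α z i≤L)) (inner 0<i i<L)
      ... | inj₂ refl = subst P (sym (trans (snoc-≤ α z i≤L) end)) (Py 0<i)

    walkAlong : ∀ {S x u v L α} → Walk P x u L α → ConnectedIn G S u v →
      (∀ {z} → ConnectedIn G S u z → P z) → ∃₂ λ L′ α′ → Walk P x v L′ α′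
    walkAlong w (here _)          toP = _ , _ , w
    walkAlong w (step u⇝t tv _) toP =
      let _ , _ , w′ = walkAlong w u⇝t toP in _ , _ , snocWalk w′ (λ _ → toP u⇝t) tv

  walkThroughComponent : ∀ {S a x y u v} → ConnectedIn G S a u → ConnectedIn G S a v →
    Adj G x u → Adj G v y → ∃₂ λ L α → Walk (ConnectedIn G S a) x y L α
  walkThroughComponent a⇝u a⇝v xu vy =
    let _ , _ , x⋯v = walkAlong (snocWalk trivialWalk (λ ()) xu) u⇝v (connected-trans a⇝u)
    in _ , _ , snocWalk x⋯v (λ _ → a⇝v) vy
    where u⇝v = connected-trans (connected-sym a⇝u) a⇝v

  record IsInducedPath (L : ℕ) (α : ℕ → Fin n) : Set where
    field
      consecutive : ∀ {i j} → i ≤ L → j ≤ L → Adj G (α i) (α j) → j ≡ suc i ⊎ i ≡ suc j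
      injective   : ∀ {i j} → i ≤ L → j ≤ L → α i ≡ α j → i ≡ j

  module _ {P : Fin n → Set} {x y : Fin n} where

    skip : (ℕ → Fin n) → ℕ → ℕ → ℕ → Fin n
    skip α i d k with k ≤? i
    ... | yes _ = α k
    ... | no  _ = α (k + d)

    skip-≤ : ∀ α {i} d {k} → k ≤ i → skip α i d k ≡ α k
    skip-≤ α {i} d {k} k≤i with k ≤? i
    ... | yes _   = refl
    ... | no  k≰i = contradiction k≤i k≰i

    skip-> : ∀ α {i} d {k} → i < k → skip α i d k ≡ α (k + d)
    skip-> α {i} d {k} i<k with k ≤? i
    ... | yes k≤i = contradiction i<k (ℕ.≤⇒≯ k≤i)
    ... | no  _   = refl

    -- Removes α (suc i), …, α (i + d); the seam α i → α (suc i + d) must be an edge.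
    skipWalk : ∀ {L α} L′ d i → Walk P x y L α → L ≡ L′ + d → i ≤ L′ →
      (i < L′ → Adj G (α i) (α (suc i + d))) → (i ≡ L′ → α i ≡ y) → Walk P x y L′ (skip α i d)
    skipWalk {L} {α} L′ d i w L≡L′+d i≤L′ seam i≡L′⇒y = record
      { start = trans (skip-≤ α {i} d z≤n) start
      ; end   = end′
      ; steps = steps′
      ; inner = inner′
      }
      where
      open Walk w
      L′≤L : L′ ≤ L
      L′≤L = subst (L′ ≤_) (sym L≡L′+d) (ℕ.m≤m+n L′ d)
      k+d<L : ∀ {k} → k < L′ → k + d < L
      k+d<L k<L′ = subst (_ + d <_) (sym L≡L′+d) (ℕ.+-monoˡ-< d k<L′)
      end′ : skip α i d L′ ≡ y
      end′ with L′ ≤? i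
      ... | yes L′≤i = let i≡L′ = ℕ.≤-antisym i≤L′ L′≤i in subst (λ k → α k ≡ y) i≡L′ (i≡L′⇒y i≡L′)
      ... | no  _    = trans (cong α (sym L≡L′+d)) end
      steps′ : ∀ {k} → k < L′ → Adj G (skip α i d k) (skip α i d (suc k))
      steps′ {k} k<L′ with ℕ.<-cmp k i
      ... | tri< k<i _ _  = subst₂ (Adj G) (sym (skip-≤ α d (ℕ.<⇒≤ k<i))) (sym (skip-≤ α d k<i))
                              (steps (ℕ.<-≤-trans k<L′ L′≤L))
      ... | tri≈ _ refl _ = subst₂ (Adj G) (sym (skip-≤ α d ℕ.≤-refl)) (sym (skip-> α d ℕ.≤-refl)) (seam k<L′)
      ... | tri> _ _ i<k  = subst₂ (Adj G) (sym (skip-> α d i<k)) (sym (skip-> α d (ℕ.m<n⇒m<1+n i<k)))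
                              (steps (k+d<L k<L′))
      inner′ : ∀ {k} → 0 < k → k < L′ → P (skip α i d k)
      inner′ {k} 0<k k<L′ with k ≤? i
      ... | yes _ = inner 0<k (ℕ.<-≤-trans k<L′ L′≤L)
      ... | no  _ = inner (ℕ.<-≤-trans 0<k (ℕ.m≤m+n k d)) (k+d<L k<L′)

    Shortest : ℕ → Set
    Shortest L = ∀ {L′} → L′ < L → ∀ α′ → ¬ Walk P x y L′ α′

    shortest⇒chordless : ∀ {L α} → Walk P x y L α → Shortest L →
      ∀ {i j} → suc i < j → j ≤ L → ¬ Adj G (α i) (α j)
    shortest⇒chordless {α = α} w shortest {i} 1+i<j j≤L αiαj
      with ℕ.m≤n⇒∃[o]m+o≡n 1+i<j | ℕ.m≤n⇒∃[o]m+o≡n j≤L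
    ... | d , refl | r , refl =
      shortest (subst (suc (i + r) <_) (sym L≡) (ℕ.m<m+n _ (s≤s z≤n))) _
        (skipWalk (suc (i + r)) (suc d) i w L≡ (ℕ.m≤n⇒m≤1+n (ℕ.m≤m+n i r))
          (λ _ → subst (λ k → Adj G (α i) (α k)) (cong suc (sym (ℕ.+-suc i d))) αiαj)
          (⊥-elim ∘ ℕ.m≢1+m+n i))
      where
      rearrange : ∀ i d r → suc (suc i) + d + r ≡ suc (i + r) + suc d
      rearrange = solve-∀
      L≡ : suc (suc i) + d + r ≡ suc (i + r) + suc d
      L≡ = rearrange i d r

    shortest⇒injective : ∀ {L α} → Walk P x y L α → Shortest L →
      ∀ {i j} → i < j → j ≤ L → α i ≢ α j
    shortest⇒injective {α = α} w shortest {i} i<j j≤L αi≡αj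
      with ℕ.m≤n⇒∃[o]m+o≡n i<j | ℕ.m≤n⇒∃[o]m+o≡n j≤L
    ... | d , refl | r , refl =
      shortest (subst (i + r <_) (sym L≡) (ℕ.m<m+n _ (s≤s z≤n))) _
        (skipWalk (i + r) (suc d) i w L≡ (ℕ.m≤m+n i r) seam end′)
      where
      open Walk w
      rearrange : ∀ i d r → suc i + d + r ≡ i + r + suc d
      rearrange = solve-∀
      L≡ : suc i + d + r ≡ i + r + suc d
      L≡ = rearrange i d r
      j≡ : suc i + d ≡ i + suc d
      j≡ = sym (ℕ.+-suc i d)
      seam : i < i + r → Adj G (α i) (α (suc (i + suc d)))
      seam i<i+r = subst (λ v → Adj G v (α (suc (i + suc d)))) (sym (trans αi≡αj (cong α j≡)))
        (steps (subst (i + suc d <_) (sym L≡) (ℕ.+-monoˡ-< (suc d) i<i+r)))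
      end′ : i ≡ i + r → α i ≡ y
      end′ i≡i+r = trans αi≡αj (trans (cong α (trans j≡ (cong (_+ suc d) i≡i+r))) (trans (cong α (sym L≡)) end))

    shortest⇒induced : ∀ {L α} → Walk P x y L α → Shortest L → IsInducedPath L α
    shortest⇒induced {L} {α} w shortest = record { consecutive = consecutive ; injective = injective }
      where
      consecutive : ∀ {i j} → i ≤ L → j ≤ L → Adj G (α i) (α j) → j ≡ suc i ⊎ i ≡ suc j
      consecutive {i} {j} i≤L j≤L αiαj with ℕ.<-cmp i j
      ... | tri≈ _ refl _ = ⊥-elim (irr (α i) αiαj)
      ... | tri< i<j _ _ with ℕ.m≤n⇒m<n∨m≡n i<j
      ...   | inj₁ 1+i<j = ⊥-elim (shortest⇒chordless w shortest 1+i<j j≤L αiαj)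
      ...   | inj₂ 1+i≡j = inj₁ (sym 1+i≡j)
      consecutive {i} {j} i≤L j≤L αiαj | tri> _ _ j<i with ℕ.m≤n⇒m<n∨m≡n j<i
      ...   | inj₁ 1+j<i = ⊥-elim (shortest⇒chordless w shortest 1+j<i i≤L (Adj-sym αiαj))
      ...   | inj₂ 1+j≡i = inj₂ (sym 1+j≡i)
      injective : ∀ {i j} → i ≤ L → j ≤ L → α i ≡ α j → i ≡ j
      injective {i} {j} i≤L j≤L αi≡αj with ℕ.<-cmp i j
      ... | tri≈ _ i≡j _ = i≡j
      ... | tri< i<j _ _ = ⊥-elim (shortest⇒injective w shortest i<j j≤L αi≡αj)
      ... | tri> _ _ j<i = ⊥-elim (shortest⇒injective w shortest j<i i≤L (sym αi≡αj))

    -- Constructively we cannot decide whether a shorter walk exists, hence the double negation.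
    walk⇒¬¬inducedWalk : ∀ {L α} → Walk P x y L α →
      ¬ ¬ (∃₂ λ L′ α′ → Walk P x y L′ α′ × IsInducedPath L′ α′)
    walk⇒¬¬inducedWalk {L} {α} w ∄induced = noWalk L α w
      where
      noWalk : ∀ L α → ¬ Walk P x y L α
      noWalk = <-rec (λ L → ∀ α → ¬ Walk P x y L α)
        (λ L shorter α w → ∄induced (L , α , w , shortest⇒induced w (λ L′<L → shorter L′<L)))

    walk-length≥2 : ∀ {L α} → Walk P x y L α → x ≢ y → ¬ Adj G x y → 2 ≤ L
    walk-length≥2 {zero}        w x≢y _    = ⊥-elim (x≢y (trans (sym (Walk.start w)) (Walk.end w)))
    walk-length≥2 {suc zero}    w _   x≁y  =
      ⊥-elim (x≁y (subst₂ (Adj G) (Walk.start w) (Walk.end w) (Walk.steps w (s≤s z≤n))))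
    walk-length≥2 {suc (suc L)} w _   _    = s≤s (s≤s z≤n)

  module Gluing {PA PB : Fin n → Set} {x y : Fin n} {LA LB : ℕ} {α β : ℕ → Fin n}
    (αwalk : Walk PA x y LA α) (αinduced : IsInducedPath LA α)
    (βwalk : Walk PB y x LB β) (βinduced : IsInducedPath LB β)
    (nonadjacent : ∀ {u v} → PA u → PB v → ¬ Adj G u v)
    (disjoint : ∀ {v} → PA v → ¬ PB v) where

    private
      module A = Walk αwalk
      module B = Walk βwalk
      module Aᵢ = IsInducedPath αinduced
      module Bᵢ = IsInducedPath βinduced

    α0≡βLB : α 0 ≡ β LB
    α0≡βLB = trans A.start (sym B.end)

    αLA≡β0 : α LA ≡ β 0
    αLA≡β0 = trans A.end (sym B.start)

    K : ℕ
    K = LA + LB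

    γ : ℕ → Fin n
    γ k with k ≤? LA
    ... | yes _ = α k
    ... | no  _ = β (k ∸ LA)

    γ-α : ∀ {k} → k ≤ LA → γ k ≡ α k
    γ-α {k} k≤LA with k ≤? LA
    ... | yes _    = refl
    ... | no  k≰LA = contradiction k≤LA k≰LA

    γ-β : ∀ j → γ (LA + j) ≡ β j
    γ-β j with LA + j ≤? LA
    ... | no _ = cong β (ℕ.m+n∸m≡n LA j)
    ... | yes LA+j≤LA with ℕ.n≤0⇒n≡0 (ℕ.+-cancelˡ-≤ LA j 0 (subst (LA + j ≤_) (sym (ℕ.+-identityʳ LA)) LA+j≤LA))
    ...   | refl = trans (cong α (ℕ.+-identityʳ LA)) αLA≡β0

    γ-LA : γ LA ≡ β 0
    γ-LA = trans (cong γ (sym (ℕ.+-identityʳ LA))) (γ-β 0)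

    γ-1+LA : γ (suc LA) ≡ β 1
    γ-1+LA = trans (cong γ (ℕ.+-comm 1 LA)) (γ-β 1)

    γ-K : γ K ≡ γ 0
    γ-K = trans (γ-β LB) (sym (trans (γ-α z≤n) α0≡βLB))

    data Position (k : ℕ) : Set where
      onα : k ≤ LA → Position k
      onβ : ∀ j → k ≡ LA + suc j → Position k

    position : ∀ k → Position k
    position k with k ≤? LA
    ... | yes k≤LA = onα k≤LA
    ... | no  k≰LA with ℕ.m≤n⇒∃[o]m+o≡n (ℕ.≰⇒> k≰LA)
    ...   | d , LA+1+d≡k = onβ d (trans (sym LA+1+d≡k) (sym (ℕ.+-suc LA d)))

    <K⇒<LB : ∀ {j} → LA + j < K → j < LB
    <K⇒<LB {j} = ℕ.+-cancelˡ-< LA j LB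

    γ-steps : ∀ {k} → k < K → Adj G (γ k) (γ (suc k))
    γ-steps {k} k<K with position k
    ... | onβ j refl = subst₂ (Adj G) (sym (γ-β (suc j)))
                         (sym (trans (cong γ (sym (ℕ.+-suc LA (suc j)))) (γ-β (suc (suc j)))))
                         (B.steps (<K⇒<LB k<K))
    ... | onα k≤LA with ℕ.m≤n⇒m<n∨m≡n k≤LA
    ...   | inj₁ k<LA = subst₂ (Adj G) (sym (γ-α k≤LA)) (sym (γ-α k<LA)) (A.steps k<LA)
    ...   | inj₂ refl = subst₂ (Adj G) (sym γ-LA) (sym γ-1+LA)
                          (B.steps (<K⇒<LB (subst (_< K) (sym (ℕ.+-identityʳ LA)) k<K)))

    data CyclicNeighbours (i j : ℕ) : Set where
      next  : j ≡ suc i → CyclicNeighbours i j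
      prev  : i ≡ suc j → CyclicNeighbours i j
      wrap  : i ≡ 0 → suc j ≡ K → CyclicNeighbours i j
      wrap′ : j ≡ 0 → suc i ≡ K → CyclicNeighbours i j

    neighbours-sym : ∀ {i j} → CyclicNeighbours i j → CyclicNeighbours j i
    neighbours-sym (next e)     = prev e
    neighbours-sym (prev e)     = next e
    neighbours-sym (wrap e f)   = wrap′ e f
    neighbours-sym (wrap′ e f)  = wrap e f

    α-β-neighbours : ∀ {i j} → i ≤ LA → suc j < LB → Adj G (α i) (β (suc j)) → CyclicNeighbours i (LA + suc j)
    α-β-neighbours {i} {j} i≤LA 1+j<LB αiβj with interior-or-end i≤LA
    ... | inj₁ refl
      with Bᵢ.consecutive ℕ.≤-refl (ℕ.<⇒≤ 1+j<LB) (subst (λ v → Adj G v (β (suc j))) α0≡βLB αiβj)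
    ...   | inj₁ 1+j≡1+LB = ⊥-elim (ℕ.<-asym (ℕ.n<1+n LB) (subst (_< LB) 1+j≡1+LB 1+j<LB))
    ...   | inj₂ LB≡2+j  = wrap refl (trans (sym (ℕ.+-suc LA (suc j))) (cong (LA +_) (sym LB≡2+j)))
    α-β-neighbours {i} {j} i≤LA 1+j<LB αiβj | inj₂ (inj₁ refl)
      with Bᵢ.consecutive z≤n (ℕ.<⇒≤ 1+j<LB) (subst (λ v → Adj G v (β (suc j))) αLA≡β0 αiβj)
    ...   | inj₁ 1+j≡1 = next (trans (cong (LA +_) 1+j≡1) (ℕ.+-comm LA 1))
    ...   | inj₂ ()
    α-β-neighbours {i} {j} i≤LA 1+j<LB αiβj | inj₂ (inj₂ (0<i , i<LA)) =
      ⊥-elim (nonadjacent (A.inner 0<i i<LA) (B.inner (s≤s z≤n) 1+j<LB) αiβj)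

    α≢β : ∀ {i j} → i ≤ LA → suc j < LB → α i ≢ β (suc j)
    α≢β {i} {j} i≤LA 1+j<LB αi≡βj with interior-or-end i≤LA
    ... | inj₁ refl =
      ℕ.<-irrefl (sym (Bᵢ.injective ℕ.≤-refl (ℕ.<⇒≤ 1+j<LB) (trans (sym α0≡βLB) αi≡βj))) 1+j<LB
    ... | inj₂ (inj₁ refl) with Bᵢ.injective z≤n (ℕ.<⇒≤ 1+j<LB) (trans (sym αLA≡β0) αi≡βj)
    ...   | ()
    α≢β {i} {j} i≤LA 1+j<LB αi≡βj | inj₂ (inj₂ (0<i , i<LA)) =
      disjoint (A.inner 0<i i<LA) (subst PB (sym αi≡βj) (B.inner (s≤s z≤n) 1+j<LB))

    γ-neighbours : ∀ {i j} → i < K → j < K → Adj G (γ i) (γ j) → CyclicNeighbours i j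
    γ-neighbours {i} {j} i<K j<K γiγj with position i | position j
    ... | onα i≤LA | onα j≤LA with Aᵢ.consecutive i≤LA j≤LA (subst₂ (Adj G) (γ-α i≤LA) (γ-α j≤LA) γiγj)
    ...   | inj₁ j≡1+i = next j≡1+i
    ...   | inj₂ i≡1+j = prev i≡1+j
    γ-neighbours {i} {j} i<K j<K γiγj | onα i≤LA | onβ j′ refl =
      α-β-neighbours i≤LA (<K⇒<LB j<K) (subst₂ (Adj G) (γ-α i≤LA) (γ-β (suc j′)) γiγj)
    γ-neighbours {i} {j} i<K j<K γiγj | onβ i′ refl | onα j≤LA =
      neighbours-sym
        (α-β-neighbours j≤LA (<K⇒<LB i<K) (subst₂ (Adj G) (γ-α j≤LA) (γ-β (suc i′)) (Adj-sym γiγj)))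
    γ-neighbours {i} {j} i<K j<K γiγj | onβ i′ refl | onβ j′ refl
      with Bᵢ.consecutive (ℕ.<⇒≤ (<K⇒<LB i<K)) (ℕ.<⇒≤ (<K⇒<LB j<K))
                          (subst₂ (Adj G) (γ-β (suc i′)) (γ-β (suc j′)) γiγj)
    ... | inj₁ e = next (trans (cong (LA +_) e) (ℕ.+-suc LA (suc i′)))
    ... | inj₂ e = prev (trans (cong (LA +_) e) (ℕ.+-suc LA (suc j′)))

    γ-injective : ∀ {i j} → i < K → j < K → γ i ≡ γ j → i ≡ j
    γ-injective {i} {j} i<K j<K γi≡γj with position i | position j
    ... | onα i≤LA | onα j≤LA = Aᵢ.injective i≤LA j≤LA (trans (sym (γ-α i≤LA)) (trans γi≡γj (γ-α j≤LA)))
    ... | onα i≤LA | onβ j′ refl =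
      ⊥-elim (α≢β i≤LA (<K⇒<LB j<K) (trans (sym (γ-α i≤LA)) (trans γi≡γj (γ-β (suc j′)))))
    ... | onβ i′ refl | onα j≤LA =
      ⊥-elim (α≢β j≤LA (<K⇒<LB i<K) (trans (sym (γ-α j≤LA)) (trans (sym γi≡γj) (γ-β (suc i′)))))
    ... | onβ i′ refl | onβ j′ refl = cong (LA +_) (Bᵢ.injective (ℕ.<⇒≤ (<K⇒<LB i<K)) (ℕ.<⇒≤ (<K⇒<LB j<K))
                                        (trans (sym (γ-β (suc i′))) (trans γi≡γj (γ-β (suc j′)))))

    module _ (m : ℕ) (4+m≡K : 4 + m ≡ K) where

      cycle : Fin (4 + m) → Fin n
      cycle i = γ (toℕ i)

      toℕ<K : (i : Fin (4 + m)) → toℕ i < K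
      toℕ<K i = subst (toℕ i <_) 4+m≡K (toℕ<n i)

      K%K≡0 : K % (4 + m) ≡ 0
      K%K≡0 = trans (cong (_% (4 + m)) (sym 4+m≡K)) (n%n≡0 (4 + m))

      ≡mod-self : ∀ (j : Fin (4 + m)) {k} → toℕ j ≡ k → toℕ j ≡ k % (4 + m)
      ≡mod-self j refl = sym (m<n⇒m%n≡m (toℕ<n j))

      0≡K-mod : ∀ {k} → k ≡ K → 0 ≡ k % (4 + m)
      0≡K-mod refl = sym K%K≡0

      Successor : Fin (4 + m) → Fin (4 + m) → Set
      Successor i j = toℕ j ≡ suc (toℕ i) % (4 + m)

      neighbours⇒successor : ∀ {i j} → CyclicNeighbours (toℕ i) (toℕ j) → Successor i j ⊎ Successor j i
      neighbours⇒successor {i} {j} (next j≡1+i)      = inj₁ (≡mod-self j j≡1+i)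
      neighbours⇒successor {i} {j} (prev i≡1+j)      = inj₂ (≡mod-self i i≡1+j)
      neighbours⇒successor {i} {j} (wrap i≡0 1+j≡K)  = inj₂ (trans i≡0 (0≡K-mod 1+j≡K))
      neighbours⇒successor {i} {j} (wrap′ j≡0 1+i≡K) = inj₁ (trans j≡0 (0≡K-mod 1+i≡K))

      successor⇒adjacent : ∀ {i j} → Successor i j → Adj G (cycle i) (cycle j)
      successor⇒adjacent {i} {j} j≡1+i%K with ℕ.m≤n⇒m<n∨m≡n (toℕ<n i)
      ... | inj₁ 1+i<4+m = subst (λ k → Adj G (cycle i) (γ k)) (sym (trans j≡1+i%K (m<n⇒m%n≡m 1+i<4+m)))
                             (γ-steps (toℕ<K i))
      ... | inj₂ 1+i≡4+m = subst (Adj G (cycle i)) γ[1+i]≡γj (γ-steps (toℕ<K i))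
        where
        1+i≡K : suc (toℕ i) ≡ K
        1+i≡K = trans 1+i≡4+m 4+m≡K
        γ[1+i]≡γj : γ (suc (toℕ i)) ≡ cycle j
        γ[1+i]≡γj = begin
          γ (suc (toℕ i)) ≡⟨ cong γ 1+i≡K ⟩
          γ K             ≡⟨ γ-K ⟩
          γ 0             ≡⟨ cong γ (trans (0≡K-mod 1+i≡K) (sym j≡1+i%K)) ⟩
          cycle j         ∎
          where open ≡-Reasoning

      isInducedCycle : IsInducedCycle G m cycle
      isInducedCycle =
        (λ {i} {j} ci≡cj → toℕ-injective (γ-injective (toℕ<K i) (toℕ<K j) ci≡cj)) ,
        (λ i j → mk⇔ (neighbours⇒successor {i} {j} ∘ γ-neighbours (toℕ<K i) (toℕ<K j))
                     [ successor⇒adjacent {i} {j} , Adj-sym ∘ successor⇒adjacent {j} {i} ])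

    inducedCycle : 2 ≤ LA → 2 ≤ LB → ∃₂ λ m c → IsInducedCycle G m c
    inducedCycle 2≤LA 2≤LB = K ∸ 4 , cycle (K ∸ 4) 4+m≡K , isInducedCycle (K ∸ 4) 4+m≡K
      where
      4+m≡K : 4 + (K ∸ 4) ≡ K
      4+m≡K = ℕ.m+[n∸m]≡n (ℕ.+-mono-≤ 2≤LA 2≤LB)

module Separators (G : Graph) where
  open Graph G using (n; E)
  open Walks G

  connectedIn[S-x]-split : ∀ {S a x v} → x ∈ S → a ∉ S → ConnectedIn G (S - x) a v →
    ConnectedIn G S a v ⊎ ∃[ u ] (ConnectedIn G S a u × Adj G u x)
  connectedIn[S-x]-split x∈S a∉S (here _) = inj₁ (here a∉S)
  connectedIn[S-x]-split {S} {x = x} x∈S a∉S (step {u} {v} a⇝u uv v∉S-x) with connectedIn[S-x]-split x∈S a∉S a⇝u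
  ... | inj₂ viaX = inj₂ viaX
  ... | inj₁ a⇝u′ with v ∈? S
  ...   | no  v∉S = inj₁ (step a⇝u′ uv v∉S)
  ...   | yes v∈S with v ≟ᶠ x
  ...     | yes refl = inj₂ (u , a⇝u′ , uv)
  ...     | no  v≢x  = ⊥-elim (v∉S-x (x∈p∧x≢y⇒x∈p-y v∈S v≢x))

  -- Removing x from a minimal separator must reconnect a and b, and only x can do so.
  minimal⇒¬¬neighbour : ∀ {S a b x} → Separates G S a b → (∀ T → T ⊂ S → ¬ Separates G T a b) →
    x ∈ S → ¬ ¬ (∃[ u ] (ConnectedIn G S a u × Adj G u x))
  minimal⇒¬¬neighbour {S} {a} {b} {x} (a∉S , b∉S , a≁b) minimal x∈S ∄u =
    minimal (S - x) (x∈p⇒p-x⊂p x∈S) (a∉S ∘ p─q⊆p S ⁅ x ⁆ , b∉S ∘ p─q⊆p S ⁅ x ⁆ , reconnects)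
    where
    reconnects : ¬ ConnectedIn G (S - x) a b
    reconnects a⇝b with connectedIn[S-x]-split x∈S a∉S a⇝b
    ... | inj₁ a⇝b′ = a≁b a⇝b′
    ... | inj₂ viaX = ∄u viaX

  separates-sym : ∀ {S a b} → Separates G S a b → Separates G S b a
  separates-sym (a∉S , b∉S , a≁b) = b∉S , a∉S , a≁b ∘ connected-sym

  chordal⇒minimalSeparator-clique : Chordal G → ∀ {S} → MinimalSeparator G S →
    ∀ {x y} → x ∈ S → y ∈ S → x ≢ y → Adj G x y
  chordal⇒minimalSeparator-clique chordal {S} (a , b , separates , minimal) {x} {y} x∈S y∈S x≢y
    with T? (E x y)
  ... | yes x~y = x~y
  ... | no  x≁y =
    ⊥-elim (minimal⇒¬¬neighbour separates minimal x∈S λ (ua , a⇝ua , ua~x) →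
            minimal⇒¬¬neighbour separates minimal y∈S λ (va , a⇝va , va~y) →
            minimal⇒¬¬neighbour separatesᵇ minimalᵇ x∈S λ (ub , b⇝ub , ub~x) →
            minimal⇒¬¬neighbour separatesᵇ minimalᵇ y∈S λ (vb , b⇝vb , vb~y) →
            let _ , _ , xy-walk = walkThroughComponent a⇝ua a⇝va (Adj-sym ua~x) va~y
                _ , _ , yx-walk = walkThroughComponent b⇝vb b⇝ub (Adj-sym vb~y) ub~x
            in walk⇒¬¬inducedWalk xy-walk λ (_ , _ , α , αinduced) →
               walk⇒¬¬inducedWalk yx-walk λ (_ , _ , β , βinduced) →
               let _ , _ , cycle = Gluing.inducedCycle α αinduced β βinduced nonadjacent disjoint
                                     (walk-length≥2 α x≢y x≁y)
                                     (walk-length≥2 β (x≢y ∘ sym) (x≁y ∘ Adj-sym))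
               in chordal _ _ cycle)
    where
    separatesᵇ = separates-sym separates
    minimalᵇ : ∀ T → T ⊂ S → ¬ Separates G T b a
    minimalᵇ T T⊂S = minimal T T⊂S ∘ separates-sym
    a≁b = proj₂ (proj₂ separates)
    nonadjacent : ∀ {u v} → ConnectedIn G S a u → ConnectedIn G S b v → ¬ Adj G u v
    nonadjacent a⇝u b⇝v uv = a≁b (connected-trans (step a⇝u uv (connected-end∉ b⇝v)) (connected-sym b⇝v))
    disjoint : ∀ {v} → ConnectedIn G S a v → ¬ ConnectedIn G S b v
    disjoint a⇝v b⇝v = a≁b (connected-trans a⇝v (connected-sym b⇝v))

proposition3 : (G : Graph) → Chordal G →
    (w : Fin (Graph.n G) → Fin (Graph.n G) → ℚ) →
    (∀ u v → w u v ≡ w v u) →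
    (∀ u v → Adj G u v → 0ℚ ≤ℚ w u v) →
    ∃[ M ] (IsMaxWeightMatching G w M ×
      (∀ S → MinimalSeparator G S →
        (∣ S ∣ ∸ 1 ≤ coveredIn G M S) × (coveredIn G M S ≤ ∣ S ∣)))
proposition3 G chordal w _ nonneg =
  heaviest w , heaviest-isMaxWeight w , λ S separator →
    ∣S∣∸1≤coveredIn (heaviest-isMatching w) (heaviest-maximal w nonneg)
      (chordal⇒minimalSeparator-clique chordal separator) ,
    count≤∣p∣ S (proj₂ (heaviest-isMatching w))
  where
  open Matchings G
  open Separators G
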